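{- Let $\bar z$ be an optimal solution of [GKC] satisfying $1\ge\bar z_{i1}\ge\dots\ge\bar z_{im}\ge0$ for all $i\in N$, define $\bar a,\bar D,\bar m_i$ and [R-GKC] as in the context, let $z^*$ be an optimal extreme point solution of [R-GKC], and let $k\in N$ be the unique item (if any) with some $z^*_{kj}\in(0,1)$ (all other items have $z^*_{ij}\in\{0,1\}$). Define $\hat z\in\mathbb{R}^{N\times M}$ by $\hat z_{ij}=1$ for $i\in N$, $j\in\{1,\dots,\bar a_i\}$; $\hat z_{ij}=z^*_{ij}$ for $i\in N\setminus\{k\}$, $j\in\{\bar a_i+1,\dots,\bar m_i\}$; and $\hat z_{ij}=0$ otherwise. Then $\hat z$ is an integral feasible solution to [GKC] and $\sum_{i,j}g_{ij}\hat z_{ij}\le2\sum_{i,j}g_{ij}\bar z_{ij}$; thus $\hat z$ is a 2-approximate solution to the Non-Linear Knapsack-Cover problem.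
   Context: Non-Linear Knapsack-Cover problem: given a finite set $N$ of items, a demand $D\in\mathbb{N}$, an integer $m\le D$, and for each $i\in N$ a non-decreasing $f_i:\{0,\dots,m\}\to\mathbb{Q}_{\ge0}\cup\{\infty\}$, choose $x\in\{0,\dots,m\}^N$ with $\sum_i x_i\ge D$ minimizing $\sum_i f_i(x_i)$; the instance is assumed feasible. $M=\{1,\dots,m\}$, $g_{ij}=f_i(j)-f_i(j-1)$; a choice $x$ corresponds to $z\in\{0,1\}^{N\times M}$ with $z_{ij}=1$ iff $x_i\ge j$. For $a\in\{0,\dots,m\}^N$ let $D(a)=\max\{D-\sum_ia_i,0\}$, $m_i(a)=\min\{m,a_i+D(a)\}$. [GKC]: minimize $\sum_{i,j}g_{ij}z_{ij}$ over $z\ge0$ subject to $\sum_{i\in N}\sum_{j=a_i+1}^{m_i(a)}\min\{z_{ij},\dots,z_{i1}\}\ge D(a)$ for all $a\in\{0,\dots,m\}^N$. Given $\bar z$: $\bar a_i=\max\{j\in M:\bar z_{ij}\ge1/2\}$ ($0$ if none), $\bar D=D(\bar a)$, $\bar m_i=m_i(\bar a)$. [R-GKC]: in variables $z_{ij}$, $i\in N$, $\bar a_i<j\le\bar m_i$, minimize $\sum_{i}\sum_{j=\bar a_i+1}^{\bar m_i}g_{ij}z_{ij}$ s.t. $\sum_{i}\sum_{j=\bar a_i+1}^{\bar m_i}z_{ij}\ge2\bar D$ and $1\ge z_{i,\bar a_i+1}\ge\dots\ge z_{i,\bar m_i}\ge0$ for all $i$.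
   Formalization: The solutions $\bar z$ and $z^*$ have rational rather than real entries, and the competing solutions in their optimality and extreme-point conditions are likewise taken in the rationals. -}

module Defs where

open import Data.Nat as ℕ using (ℕ; zero; suc; _∸_; _⊓_; _≤ᵇ_)
open import Data.Integer using (+_)
open import Data.Rational as ℚ using (ℚ; 0ℚ; 1ℚ; ½; _/_)
open import Data.Fin using (Fin; zero; suc)
open import Data.Fin.Properties using () renaming (_≟_ to _≟F_)
open import Data.Bool using (Bool; true; false; if_then_else_; _∧_; not)
open import Data.Maybe using (Maybe; just; nothing)
open import Relation.Nullary using (does)
open import Relation.Binary.PropositionalEquality using (_≡_)
open import Data.Product using (Σ; _×_)
open import Data.Sum using (_⊎_)
open import Relation.Nullary using (¬_)

data ℚ∞ : Set where
  fin : ℚ → ℚ∞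
  ∞   : ℚ∞

infixl 6 _+∞_
_+∞_ : ℚ∞ → ℚ∞ → ℚ∞
fin p +∞ fin q = fin (p ℚ.+ q)
fin _ +∞ ∞     = ∞
∞     +∞ _     = ∞

-- difference  x - y  (used for g_ij = f_i(j) - f_i(j-1));
-- convention: ∞ - anything = ∞.  (fin - ∞ never occurs for non-decreasing f.)
_-∞_ : ℚ∞ → ℚ∞ → ℚ∞
fin p -∞ fin q = fin (p ℚ.- q)
fin p -∞ ∞     = ∞
∞     -∞ _     = ∞

-- scaling by a rational (the variable value); convention ∞ · 0 = 0
scale : ℚ∞ → ℚ → ℚ∞
scale (fin p) q = fin (p ℚ.* q)
scale ∞       q = if does (q ℚ.≟ 0ℚ) then fin 0ℚ else ∞

double : ℚ∞ → ℚ∞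
double x = x +∞ x

infix 4 _≤∞_
data _≤∞_ : ℚ∞ → ℚ∞ → Set where
  fin≤fin : ∀ {p q} → p ℚ.≤ q → fin p ≤∞ fin q
  _≤∞∞    : ∀ x → x ≤∞ ∞

sumFinℕ : ∀ {n} → (Fin n → ℕ) → ℕ
sumFinℕ {zero}  h = 0
sumFinℕ {suc n} h = h zero ℕ.+ sumFinℕ (λ i → h (suc i))

sumFin : ∀ {n} → (Fin n → ℚ) → ℚ
sumFin {zero}  h = 0ℚ
sumFin {suc n} h = h zero ℚ.+ sumFin (λ i → h (suc i))

sumFin∞ : ∀ {n} → (Fin n → ℚ∞) → ℚ∞
sumFin∞ {zero}  h = fin 0ℚ
sumFin∞ {suc n} h = h zero +∞ sumFin∞ (λ i → h (suc i))

sumN : ℕ → (ℕ → ℚ) → ℚ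
sumN zero    h = 0ℚ
sumN (suc k) h = sumN k h ℚ.+ h k

sumN∞ : ℕ → (ℕ → ℚ∞) → ℚ∞
sumN∞ zero    h = fin 0ℚ
sumN∞ (suc k) h = sumN∞ k h +∞ h k

-- sumR a b h = Σ_{j = a+1}^{b} h j   (empty if b ≤ a)
sumR : ℕ → ℕ → (ℕ → ℚ) → ℚ
sumR a b h = sumN (b ∸ a) (λ t → h (a ℕ.+ suc t))

sumR∞ : ℕ → ℕ → (ℕ → ℚ∞) → ℚ∞
sumR∞ a b h = sumN∞ (b ∸ a) (λ t → h (a ℕ.+ suc t))

fromℕ : ℕ → ℚ
fromℕ k = + k / 1

-- Items are Fin n, demand D, bound m,
-- costs f i : ℕ → ℚ∞ (only values on {0,…,m} matter).
-- Variables z : Fin n → ℕ → ℚ, where z i j is z_{ij} (only j ∈ {1,…,m} matter).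

Vars : ℕ → Set
Vars n = Fin n → ℕ → ℚ

gcoef : ∀ {n} → (Fin n → ℕ → ℚ∞) → Fin n → ℕ → ℚ∞
gcoef f i j = f i j -∞ f i (j ∸ 1)

Dof : ∀ {n} → ℕ → (Fin n → ℕ) → ℕ
Dof D a = D ∸ sumFinℕ a

mof : ∀ {n} → ℕ → ℕ → (Fin n → ℕ) → Fin n → ℕ
mof D m a i = m ⊓ (a i ℕ.+ Dof D a)

-- min{h j, …, h 1}  (for j ≥ 1; value at 0 unused)
minUpTo : (ℕ → ℚ) → ℕ → ℚ
minUpTo h zero          = 1ℚ
minUpTo h (suc zero)    = h 1
minUpTo h (suc (suc j)) = h (suc (suc j)) ℚ.⊓ minUpTo h (suc j)

costG : ∀ {n} → ℕ → (Fin n → ℕ → ℚ∞) → Vars n → ℚ∞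
costG m f z = sumFin∞ (λ i → sumR∞ 0 m (λ j → scale (gcoef f i j) (z i j)))

GKCFeasible : ∀ {n} → ℕ → ℕ → Vars n → Set
GKCFeasible {n} D m z =
  (∀ (i : Fin n) (j : ℕ) → 1 ℕ.≤ j → j ℕ.≤ m → 0ℚ ℚ.≤ z i j) ×
  (∀ (a : Fin n → ℕ) → (∀ i → a i ℕ.≤ m) →
     fromℕ (Dof D a) ℚ.≤
       sumFin (λ i → sumR (a i) (mof D m a i) (λ j → minUpTo (z i) j)))

OptimalGKC : ∀ {n} → ℕ → ℕ → (Fin n → ℕ → ℚ∞) → Vars n → Set
OptimalGKC {n} D m f z =
  GKCFeasible D m z × (∀ (z' : Vars n) → GKCFeasible D m z' → costG m f z ≤∞ costG m f z')

lastHalf : (ℕ → ℚ) → ℕ → ℕ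
lastHalf h zero    = 0
lastHalf h (suc j) = if ½ ℚ.≤ᵇ h (suc j) then suc j else lastHalf h j

abar : ∀ {n} → ℕ → Vars n → Fin n → ℕ
abar m z i = lastHalf (z i) m

-- [R-GKC] relative to a vector a (used with a = ā): variables z i j for a i < j ≤ m_i(a)
InR : ∀ {n} → ℕ → ℕ → (Fin n → ℕ) → Fin n → ℕ → Set
InR D m a i j = a i ℕ.< j × j ℕ.≤ mof D m a i

RFeasible : ∀ {n} → ℕ → ℕ → (Fin n → ℕ) → Vars n → Set
RFeasible {n} D m a z =
  (fromℕ (2 ℕ.* Dof D a) ℚ.≤ sumFin (λ i → sumR (a i) (mof D m a i) (z i))) ×
  (∀ (i : Fin n) (j : ℕ) → InR D m a i j → 0ℚ ℚ.≤ z i j × z i j ℚ.≤ 1ℚ) ×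
  (∀ (i : Fin n) (j : ℕ) → InR D m a i j → InR D m a i (suc j) → z i (suc j) ℚ.≤ z i j)

costR : ∀ {n} → ℕ → ℕ → (Fin n → ℕ → ℚ∞) → (Fin n → ℕ) → Vars n → ℚ∞
costR D m f a z = sumFin∞ (λ i → sumR∞ (a i) (mof D m a i) (λ j → scale (gcoef f i j) (z i j)))

OptimalR : ∀ {n} → ℕ → ℕ → (Fin n → ℕ → ℚ∞) → (Fin n → ℕ) → Vars n → Set
OptimalR {n} D m f a z =
  RFeasible D m a z × (∀ (z' : Vars n) → RFeasible D m a z' → costR D m f a z ≤∞ costR D m f a z')

ExtremeR : ∀ {n} → ℕ → ℕ → (Fin n → ℕ) → Vars n → Set
ExtremeR {n} D m a z =
  ∀ (y w : Vars n) (λ' : ℚ) → 0ℚ ℚ.< λ' → λ' ℚ.< 1ℚ →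
    RFeasible D m a y → RFeasible D m a w →
    (∀ i j → InR D m a i j → z i j ≡ λ' ℚ.* y i j ℚ.+ (1ℚ ℚ.- λ') ℚ.* w i j) →
    ∀ i j → InR D m a i j → y i j ≡ w i j

IsIntegral : ℚ → Set
IsIntegral q = q ≡ 0ℚ ⊎ q ≡ 1ℚ

-- k = just k₀ : k₀ is the (unique) item with a fractional value, all others integral;
-- k = nothing : all values integral
FracItem : ∀ {n} → ℕ → ℕ → (Fin n → ℕ) → Vars n → Maybe (Fin n) → Set
FracItem {n} D m a z nothing = ∀ i j → InR D m a i j → IsIntegral (z i j)
FracItem {n} D m a z (just k) =
  (Σ ℕ λ j → InR D m a k j × 0ℚ ℚ.< z k j × z k j ℚ.< 1ℚ) ×
  (∀ i → ¬ (i ≡ k) → ∀ j → InR D m a i j → IsIntegral (z i j))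

isItem : ∀ {n} → Maybe (Fin n) → Fin n → Bool
isItem nothing  i = false
isItem (just k) i = does (k ≟F i)

zhat : ∀ {n} → ℕ → ℕ → (Fin n → ℕ) → Vars n → Maybe (Fin n) → Vars n
zhat D m a zs k i j =
  if j ≤ᵇ a i then 1ℚ
  else if (j ≤ᵇ mof D m a i) ∧ not (isItem k i) then zs i j
  else 0ℚ

costF : ∀ {n} → (Fin n → ℕ → ℚ∞) → (Fin n → ℕ) → ℚ∞
costF f x = sumFin∞ (λ i → f i (x i))

NLKCFeasible : ∀ {n} → ℕ → ℕ → (Fin n → ℕ) → Set
NLKCFeasible D m x = (∀ i → x i ℕ.≤ m) × D ℕ.≤ sumFinℕ x

-- ẑ is 1 below ā, agrees with z* on the free range (ā, m̄] except on the fractional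
-- item k, where it is 0, and vanishes above m̄.  Each ẑ i is an integral antitone sequence, hence
-- the step function of x̂ i = lastHalf (ẑ i) m, so ẑ encodes a knapsack choice x̂.  The covering
-- constraint of [R-GKC] puts mass 2 D̄ on the free ranges and dropping item k loses at most D̄,
-- so x̂ covers D.
--
-- Below ā we have ½ ≤ z̄, so g ≤ 2 g z̄; on the free ranges ẑ ≤ z*, and z* costs no more
-- than the [R-GKC]-feasible point 2 z̄ (z̄ < ½ there); above m̄, ẑ is 0.  Hence cost ẑ ≤ 2 cost z̄.
-- Finally f i x = f i 0 + Σ_{1 ≤ j ≤ x} g i j turns this into cost x̂ ≤ 2 cost x for every feasible x,
-- because the step function of x is feasible for [GKC], where z̄ is optimal.

module Submission where

open import Defs
open import Data.Nat using (ℕ; suc; _≤_; _<_; _≤ᵇ_)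
open import Data.Rational using (ℚ; 0ℚ; 1ℚ) renaming (_≤_ to _≤ℚ_)
open import Data.Fin using (Fin)
open import Data.Maybe using (Maybe)
open import Data.Bool using (if_then_else_)
open import Data.Product using (Σ; _×_)
open import Relation.Binary.PropositionalEquality using (_≡_)

open import Algebra.Bundles using (CommutativeSemigroup)
import Algebra.Properties.CommutativeSemigroup as CommutativeSemigroupProperties
import Algebra.Properties.Group as GroupProperties
open import Algebra.Structures using (IsCommutativeMonoid)
open import Data.Bool using (true; false; T)
open import Data.Bool.Properties using (if-not)
open import Data.Empty using (⊥-elim)
open import Data.Fin using (zero; suc)
open import Data.Fin.Properties using (suc-injective) renaming (_≟_ to _≟F_)
open import Data.Integer as ℤ using (+_)
import Data.Integer.Properties as ℤP
open import Data.Maybe using (just; nothing)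
open import Data.Nat as ℕ using (zero; _∸_; _⊓_; z≤n; s≤s)
import Data.Nat.Coprimality as Coprime
import Data.Nat.Properties as ℕP
open import Data.Product using (_,_; proj₁; proj₂)
open import Data.Rational as ℚ using (½; mkℚ; _/_)
import Data.Rational.Properties as ℚP
open import Data.Sum using (inj₁; inj₂)
open import Data.Unit using (tt)
open import Level using (0ℓ)
open import Relation.Binary using (Rel; IsPreorder; Preorder; _Preserves₂_⟶_⟶_)
open import Relation.Binary.PropositionalEquality
  using (refl; sym; trans; cong; cong₂; subst; subst₂; isEquivalence; module ≡-Reasoning)
import Relation.Binary.Reasoning.Preorder
open import Relation.Nullary using (yes; no; ¬_)

module RangeSums
  {A : Set} (_⊕_ : A → A → A) (ε : A) (_≼_ : Rel A 0ℓ)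
  (isCommutativeMonoid : IsCommutativeMonoid _≡_ _⊕_ ε)
  (isPreorder : IsPreorder _≡_ _≼_)
  (⊕-mono : _⊕_ Preserves₂ _≼_ ⟶ _≼_ ⟶ _≼_)
  (Σ< : ℕ → (ℕ → A) → A)
  (Σ<-zero : ∀ h → Σ< 0 h ≡ ε)
  (Σ<-suc : ∀ k h → Σ< (suc k) h ≡ Σ< k h ⊕ h k)
  (ΣFin : ∀ {n} → (Fin n → A) → A)
  (ΣFin-zero : ∀ h → ΣFin {0} h ≡ ε)
  (ΣFin-suc : ∀ {n} h → ΣFin {suc n} h ≡ h zero ⊕ ΣFin (λ i → h (suc i)))
  where

  open IsCommutativeMonoid isCommutativeMonoid using (assoc; comm; identityˡ; identityʳ)

  ⊕-commutativeSemigroup : CommutativeSemigroup 0ℓ 0ℓ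
  ⊕-commutativeSemigroup =
    record { isCommutativeSemigroup = IsCommutativeMonoid.isCommutativeSemigroup isCommutativeMonoid }

  open CommutativeSemigroupProperties ⊕-commutativeSemigroup using (interchange) public
  open IsPreorder isPreorder using (reflexive)

  Σ[_,_] : ℕ → ℕ → (ℕ → A) → A
  Σ[ a , b ] h = Σ< (b ∸ a) (λ t → h (a ℕ.+ suc t))

  ≼-respˡ : ∀ {x y z} → x ≡ y → y ≼ z → x ≼ z
  ≼-respˡ refl p = p

  ≼-respʳ : ∀ {x y z} → x ≼ y → y ≡ z → x ≼ z
  ≼-respʳ p refl = p

  private
    Σ<-mono : ∀ k {h h'} → (∀ t → t ℕ.< k → h t ≼ h' t) → Σ< k h ≼ Σ< k h'
    Σ<-mono zero {h} {h'} _ = reflexive (trans (Σ<-zero h) (sym (Σ<-zero h')))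
    Σ<-mono (suc k) {h} {h'} le =
      ≼-respˡ (Σ<-suc k h) (≼-respʳ
        (⊕-mono (Σ<-mono k (λ t t<k → le t (ℕP.m≤n⇒m≤1+n t<k))) (le k ℕP.≤-refl))
        (sym (Σ<-suc k h')))

    Σ<-cong : ∀ k {h h'} → (∀ t → t ℕ.< k → h t ≡ h' t) → Σ< k h ≡ Σ< k h'
    Σ<-cong zero {h} {h'} _ = trans (Σ<-zero h) (sym (Σ<-zero h'))
    Σ<-cong (suc k) {h} {h'} eq =
      trans (Σ<-suc k h) (trans
        (cong₂ _⊕_ (Σ<-cong k (λ t t<k → eq t (ℕP.m≤n⇒m≤1+n t<k))) (eq k ℕP.≤-refl))
        (sym (Σ<-suc k h')))

    Σ<-+ : ∀ p q h → Σ< (p ℕ.+ q) h ≡ Σ< p h ⊕ Σ< q (λ t → h (p ℕ.+ t))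
    Σ<-+ p zero h = begin
      Σ< (p ℕ.+ 0) h ≡⟨ cong (λ k → Σ< k h) (ℕP.+-identityʳ p) ⟩
      Σ< p h         ≡⟨ sym (identityʳ _) ⟩
      Σ< p h ⊕ ε     ≡⟨ cong (Σ< p h ⊕_) (sym (Σ<-zero _)) ⟩
      Σ< p h ⊕ Σ< 0 (λ t → h (p ℕ.+ t)) ∎
      where open ≡-Reasoning
    Σ<-+ p (suc q) h = begin
      Σ< (p ℕ.+ suc q) h                                  ≡⟨ cong (λ k → Σ< k h) (ℕP.+-suc p q) ⟩
      Σ< (suc (p ℕ.+ q)) h                                ≡⟨ Σ<-suc (p ℕ.+ q) h ⟩
      Σ< (p ℕ.+ q) h ⊕ h (p ℕ.+ q)                          ≡⟨ cong (_⊕ h (p ℕ.+ q)) (Σ<-+ p q h) ⟩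
      (Σ< p h ⊕ Σ< q (λ t → h (p ℕ.+ t))) ⊕ h (p ℕ.+ q)     ≡⟨ assoc _ _ _ ⟩
      Σ< p h ⊕ (Σ< q (λ t → h (p ℕ.+ t)) ⊕ h (p ℕ.+ q))     ≡⟨ cong (Σ< p h ⊕_) (sym (Σ<-suc q _)) ⟩
      Σ< p h ⊕ Σ< (suc q) (λ t → h (p ℕ.+ t))               ∎
      where open ≡-Reasoning

    Σ<-⊕ : ∀ k h h' → Σ< k (λ t → h t ⊕ h' t) ≡ Σ< k h ⊕ Σ< k h'
    Σ<-⊕ zero h h' =
      trans (Σ<-zero _) (sym (trans (cong₂ _⊕_ (Σ<-zero h) (Σ<-zero h')) (identityˡ ε)))
    Σ<-⊕ (suc k) h h' =
      trans (Σ<-suc k _) (trans (cong (_⊕ (h k ⊕ h' k)) (Σ<-⊕ k h h'))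
        (trans (interchange _ _ _ _) (sym (cong₂ _⊕_ (Σ<-suc k h) (Σ<-suc k h')))))

    index-bounds : ∀ {a b t} → t ℕ.< b ∸ a → a ℕ.< a ℕ.+ suc t × a ℕ.+ suc t ℕ.≤ b
    index-bounds {a} {b} {t} t<b∸a = ℕP.m<m+n a (s≤s z≤n) , (begin
      a ℕ.+ suc t   ≤⟨ ℕP.+-monoʳ-≤ a t<b∸a ⟩
      a ℕ.+ (b ∸ a) ≡⟨ ℕP.m+[n∸m]≡n a≤b ⟩
      b             ∎)
      where
      open ℕP.≤-Reasoning
      a≤b : a ℕ.≤ b
      a≤b = ℕP.<⇒≤ (ℕP.m∸n≢0⇒n<m (λ b∸a≡0 → ℕP.n≮0 (subst (t ℕ.<_) b∸a≡0 t<b∸a)))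

  Σ-mono : ∀ a b {h h'} → (∀ j → a ℕ.< j → j ℕ.≤ b → h j ≼ h' j) → Σ[ a , b ] h ≼ Σ[ a , b ] h'
  Σ-mono a b le = Σ<-mono (b ∸ a) (λ t t< → let (a<j , j≤b) = index-bounds t< in le _ a<j j≤b)

  Σ-cong : ∀ a b {h h'} → (∀ j → a ℕ.< j → j ℕ.≤ b → h j ≡ h' j) → Σ[ a , b ] h ≡ Σ[ a , b ] h'
  Σ-cong a b eq = Σ<-cong (b ∸ a) (λ t t< → let (a<j , j≤b) = index-bounds t< in eq _ a<j j≤b)

  Σ-ε : ∀ a b {h} → (∀ j → a ℕ.< j → j ℕ.≤ b → h j ≡ ε) → Σ[ a , b ] h ≡ ε
  Σ-ε a b eq = trans (Σ-cong a b eq) (Σ<-ε (b ∸ a))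
    where
    Σ<-ε : ∀ k → Σ< k (λ _ → ε) ≡ ε
    Σ<-ε zero    = Σ<-zero _
    Σ<-ε (suc k) = trans (Σ<-suc k _) (trans (cong (_⊕ ε) (Σ<-ε k)) (identityʳ ε))

  Σ-nonneg : ∀ a b {h} → (∀ j → a ℕ.< j → j ℕ.≤ b → ε ≼ h j) → ε ≼ Σ[ a , b ] h
  Σ-nonneg a b le = ≼-respˡ (sym (Σ-ε a b (λ _ _ _ → refl))) (Σ-mono a b le)

  Σ-⊕ : ∀ a b h h' → Σ[ a , b ] (λ j → h j ⊕ h' j) ≡ Σ[ a , b ] h ⊕ Σ[ a , b ] h'
  Σ-⊕ a b h h' = Σ<-⊕ (b ∸ a) _ _

  Σ-split : ∀ {a b c} h → a ℕ.≤ b → b ℕ.≤ c → Σ[ a , c ] h ≡ Σ[ a , b ] h ⊕ Σ[ b , c ] h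
  Σ-split {a} {b} {c} h a≤b b≤c = begin
    Σ[ a , c ] h
      ≡⟨ cong (λ k → Σ< k (λ t → h (a ℕ.+ suc t))) (sym c∸a≡) ⟩
    Σ< ((b ∸ a) ℕ.+ (c ∸ b)) (λ t → h (a ℕ.+ suc t))
      ≡⟨ Σ<-+ (b ∸ a) (c ∸ b) _ ⟩
    Σ[ a , b ] h ⊕ Σ< (c ∸ b) (λ t → h (a ℕ.+ suc ((b ∸ a) ℕ.+ t)))
      ≡⟨ cong (Σ[ a , b ] h ⊕_) (Σ<-cong (c ∸ b) (λ t _ → cong h (shift t))) ⟩
    Σ[ a , b ] h ⊕ Σ[ b , c ] h ∎
    where
    open ≡-Reasoning
    c∸a≡ : (b ∸ a) ℕ.+ (c ∸ b) ≡ c ∸ a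
    c∸a≡ = trans (sym (ℕP.m+n∸m≡n a _)) (cong (_∸ a) (trans (sym (ℕP.+-assoc a (b ∸ a) (c ∸ b)))
      (trans (cong (ℕ._+ (c ∸ b)) (ℕP.m+[n∸m]≡n a≤b)) (ℕP.m+[n∸m]≡n b≤c))))
    shift : ∀ t → a ℕ.+ suc ((b ∸ a) ℕ.+ t) ≡ b ℕ.+ suc t
    shift t = begin
      a ℕ.+ suc ((b ∸ a) ℕ.+ t) ≡⟨ ℕP.+-suc a _ ⟩
      suc (a ℕ.+ ((b ∸ a) ℕ.+ t)) ≡⟨ cong suc (sym (ℕP.+-assoc a (b ∸ a) t)) ⟩
      suc (a ℕ.+ (b ∸ a) ℕ.+ t) ≡⟨ cong (λ x → suc (x ℕ.+ t)) (ℕP.m+[n∸m]≡n a≤b) ⟩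
      suc (b ℕ.+ t) ≡⟨ sym (ℕP.+-suc b t) ⟩
      b ℕ.+ suc t ∎

  ΣFin-cong : ∀ {n} {h h' : Fin n → A} → (∀ i → h i ≡ h' i) → ΣFin h ≡ ΣFin h'
  ΣFin-cong {zero} {h} {h'} _ = trans (ΣFin-zero h) (sym (ΣFin-zero h'))
  ΣFin-cong {suc n} {h} {h'} eq =
    trans (ΣFin-suc h) (trans (cong₂ _⊕_ (eq zero) (ΣFin-cong (λ i → eq (suc i)))) (sym (ΣFin-suc h')))

  ΣFin-mono : ∀ {n} {h h' : Fin n → A} → (∀ i → h i ≼ h' i) → ΣFin h ≼ ΣFin h'
  ΣFin-mono {zero} {h} {h'} _ = reflexive (trans (ΣFin-zero h) (sym (ΣFin-zero h')))
  ΣFin-mono {suc n} {h} {h'} le =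
    ≼-respˡ (ΣFin-suc h) (≼-respʳ (⊕-mono (le zero) (ΣFin-mono (λ i → le (suc i)))) (sym (ΣFin-suc h')))

  ΣFin-⊕ : ∀ {n} (h h' : Fin n → A) → ΣFin (λ i → h i ⊕ h' i) ≡ ΣFin h ⊕ ΣFin h'
  ΣFin-⊕ {zero} h h' = trans (ΣFin-zero _) (sym (trans (cong₂ _⊕_ (ΣFin-zero h) (ΣFin-zero h')) (identityˡ ε)))
  ΣFin-⊕ {suc n} h h' =
    trans (ΣFin-suc _) (trans (cong (_ ⊕_) (ΣFin-⊕ (λ i → h (suc i)) (λ i → h' (suc i))))
      (trans (interchange _ _ _ _) (sym (cong₂ _⊕_ (ΣFin-suc h) (ΣFin-suc h')))))

  ΣFin-nonneg : ∀ {n} (h : Fin n → A) → (∀ i → ε ≼ h i) → ε ≼ ΣFin h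
  ΣFin-nonneg {zero} h _ = reflexive (sym (ΣFin-zero h))
  ΣFin-nonneg {suc n} h le =
    ≼-respˡ (sym (identityˡ ε)) (≼-respʳ (⊕-mono (le zero) (ΣFin-nonneg _ (λ i → le (suc i)))) (sym (ΣFin-suc h)))

  ΣFin-mono-except : ∀ {n} (k : Fin n) (h g : Fin n → A) (c : A) →
    (∀ i → ¬ i ≡ k → h i ≼ g i) → h k ≼ (g k ⊕ c) → ΣFin h ≼ (ΣFin g ⊕ c)
  ΣFin-mono-except {suc n} zero h g c le lek =
    ≼-respˡ (ΣFin-suc h) (≼-respʳ (⊕-mono lek (ΣFin-mono (λ i → le (suc i) (λ ()))))
      (trans (assoc _ _ _) (trans (cong (g zero ⊕_) (comm c _))
        (trans (sym (assoc _ _ _)) (cong (_⊕ c) (sym (ΣFin-suc g)))))))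
  ΣFin-mono-except {suc n} (suc k) h g c le lek =
    ≼-respˡ (ΣFin-suc h) (≼-respʳ
      (⊕-mono (le zero (λ ())) (ΣFin-mono-except k _ _ c (λ i i≢k → le (suc i) (λ eq → i≢k (suc-injective eq))) lek))
      (trans (sym (assoc _ _ _)) (cong (_⊕ c) (sym (ΣFin-suc g)))))

module ℚ+ = GroupProperties ℚP.+-0-group

0≤1 : 0ℚ ℚ.≤ 1ℚ
0≤1 = ℚP.<⇒≤ (ℚP.positive⁻¹ 1ℚ)

½≰0 : ¬ ½ ℚ.≤ 0ℚ
½≰0 ½≤0 = ℚP.<-irrefl refl (ℚP.<-≤-trans (ℚP.positive⁻¹ ½) ½≤0)

+-cancelʳ-≤ : ∀ {p q} r → p ℚ.+ r ℚ.≤ q ℚ.+ r → p ℚ.≤ q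
+-cancelʳ-≤ {p} {q} r p+r≤q+r = subst₂ ℚ._≤_ (ℚ+.//-rightDividesʳ r p) (ℚ+.//-rightDividesʳ r q)
  (ℚP.+-monoˡ-≤ (ℚ.- r) p+r≤q+r)

-- fromℕ k = + k / 1 goes through normalisation; its normal form makes ℚ arithmetic compute.
fromℕ≡mkℚ : ∀ k → fromℕ k ≡ mkℚ (+ k) 0 (Coprime.sym (Coprime.1-coprimeTo k))
fromℕ≡mkℚ k = ℚP.normalize-coprime (Coprime.sym (Coprime.1-coprimeTo k))

fromℕ-+ : ∀ a b → fromℕ (a ℕ.+ b) ≡ fromℕ a ℚ.+ fromℕ b
fromℕ-+ a b = sym (begin
  fromℕ a ℚ.+ fromℕ b
    ≡⟨ cong₂ ℚ._+_ (fromℕ≡mkℚ a) (fromℕ≡mkℚ b) ⟩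
  ((+ a ℤ.* + 1) ℤ.+ (+ b ℤ.* + 1)) / 1
    ≡⟨ cong (_/ 1) (cong₂ ℤ._+_ (ℤP.*-identityʳ (+ a)) (ℤP.*-identityʳ (+ b))) ⟩
  fromℕ (a ℕ.+ b) ∎)
  where open ≡-Reasoning

fromℕ-mono-≤ : ∀ {a b} → a ℕ.≤ b → fromℕ a ℚ.≤ fromℕ b
fromℕ-mono-≤ {a} {b} a≤b rewrite fromℕ≡mkℚ a | fromℕ≡mkℚ b =
  ℚ.*≤* (subst₂ ℤ._≤_ (sym (ℤP.*-identityʳ (+ a))) (sym (ℤP.*-identityʳ (+ b))) (ℤ.+≤+ a≤b))

fromℕ-cancel-≤ : ∀ {a b} → fromℕ a ℚ.≤ fromℕ b → a ℕ.≤ b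
fromℕ-cancel-≤ {a} {b} le rewrite fromℕ≡mkℚ a | fromℕ≡mkℚ b with le
... | ℚ.*≤* a≤b = ℤP.drop‿+≤+ (subst₂ ℤ._≤_ (ℤP.*-identityʳ (+ a)) (ℤP.*-identityʳ (+ b)) a≤b)

+-∸-+-≤ : ∀ p q r s → (p ℕ.+ r) ∸ (q ℕ.+ s) ℕ.≤ (p ∸ q) ℕ.+ (r ∸ s)
+-∸-+-≤ p q r s = ℕP.m≤n+o⇒m∸n≤o (p ℕ.+ r) (q ℕ.+ s) (begin
  p ℕ.+ r                                 ≤⟨ ℕP.+-mono-≤ (ℕP.m≤n+m∸n p q) (ℕP.m≤n+m∸n r s) ⟩
  (q ℕ.+ (p ∸ q)) ℕ.+ (s ℕ.+ (r ∸ s))     ≡⟨ CommutativeSemigroupProperties.interchange ℕP.+-commutativeSemigroup q _ s _ ⟩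
  (q ℕ.+ s) ℕ.+ ((p ∸ q) ℕ.+ (r ∸ s))     ∎)
  where open ℕP.≤-Reasoning

sumFinℕ-∸ : ∀ {n} (x a : Fin n → ℕ) → sumFinℕ x ∸ sumFinℕ a ℕ.≤ sumFinℕ (λ i → x i ∸ a i)
sumFinℕ-∸ {zero}  x a = z≤n
sumFinℕ-∸ {suc n} x a = ℕP.≤-trans (+-∸-+-≤ (x zero) (a zero) _ _)
  (ℕP.+-monoʳ-≤ (x zero ∸ a zero) (sumFinℕ-∸ (λ i → x (suc i)) (λ i → a (suc i))))

⊓-+-≤ : ∀ d p q → d ⊓ (p ℕ.+ q) ℕ.≤ (d ⊓ p) ℕ.+ (d ⊓ q)
⊓-+-≤ d p q with ℕP.≤-total d p | ℕP.≤-total d q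
... | inj₁ d≤p | _ rewrite ℕP.m≤n⇒m⊓n≡m d≤p = ℕP.≤-trans (ℕP.m⊓n≤m d (p ℕ.+ q)) (ℕP.m≤m+n d _)
... | inj₂ _ | inj₁ d≤q rewrite ℕP.m≤n⇒m⊓n≡m d≤q = ℕP.≤-trans (ℕP.m⊓n≤m d (p ℕ.+ q)) (ℕP.m≤n+m d _)
... | inj₂ p≤d | inj₂ q≤d rewrite ℕP.m≥n⇒m⊓n≡n p≤d | ℕP.m≥n⇒m⊓n≡n q≤d = ℕP.m⊓n≤n d (p ℕ.+ q)

⊓-sumFinℕ-≤ : ∀ {n} d (y : Fin n → ℕ) → d ⊓ sumFinℕ y ℕ.≤ sumFinℕ (λ i → d ⊓ y i)
⊓-sumFinℕ-≤ {zero}  d y = ℕP.≤-reflexive (ℕP.⊓-zeroʳ d)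
⊓-sumFinℕ-≤ {suc n} d y =
  ℕP.≤-trans (⊓-+-≤ d (y zero) _) (ℕP.+-monoʳ-≤ (d ⊓ y zero) (⊓-sumFinℕ-≤ d (λ i → y (suc i))))

⊓-∸-≤ : ∀ {m x} a d → x ℕ.≤ m → d ⊓ (x ∸ a) ℕ.≤ ((m ⊓ (a ℕ.+ d)) ∸ a) ⊓ (x ∸ a)
⊓-∸-≤ {m} {x} a d x≤m = ℕP.⊓-glb
  (subst (d ⊓ (x ∸ a) ℕ.≤_) (sym range≡)
    (ℕP.⊓-glb (ℕP.≤-trans (ℕP.m⊓n≤n d _) (ℕP.∸-monoˡ-≤ a x≤m)) (ℕP.m⊓n≤m d _)))
  (ℕP.m⊓n≤n d _)
  where
  range≡ : (m ⊓ (a ℕ.+ d)) ∸ a ≡ (m ∸ a) ⊓ d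
  range≡ = trans (ℕP.∸-distribʳ-⊓ a m (a ℕ.+ d)) (cong ((m ∸ a) ⊓_) (ℕP.m+n∸m≡n a d))

+∞-assoc : ∀ x y z → (x +∞ y) +∞ z ≡ x +∞ (y +∞ z)
+∞-assoc (fin p) (fin q) (fin r) = cong fin (ℚP.+-assoc p q r)
+∞-assoc (fin p) (fin q) ∞       = refl
+∞-assoc (fin p) ∞       z       = refl
+∞-assoc ∞       y       z       = refl

+∞-comm : ∀ x y → x +∞ y ≡ y +∞ x
+∞-comm (fin p) (fin q) = cong fin (ℚP.+-comm p q)
+∞-comm (fin p) ∞       = refl
+∞-comm ∞       (fin q) = refl
+∞-comm ∞       ∞       = refl

+∞-identityˡ : ∀ x → fin 0ℚ +∞ x ≡ x
+∞-identityˡ (fin p) = cong fin (ℚP.+-identityˡ p)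
+∞-identityˡ ∞       = refl

+∞-identityʳ : ∀ x → x +∞ fin 0ℚ ≡ x
+∞-identityʳ x = trans (+∞-comm x (fin 0ℚ)) (+∞-identityˡ x)

+∞-0-isCommutativeMonoid : IsCommutativeMonoid _≡_ _+∞_ (fin 0ℚ)
+∞-0-isCommutativeMonoid = record
  { isMonoid = record
    { isSemigroup = record
      { isMagma = record { isEquivalence = isEquivalence ; ∙-cong = cong₂ _+∞_ }
      ; assoc = +∞-assoc
      }
    ; identity = +∞-identityˡ , +∞-identityʳ
    }
  ; comm = +∞-comm
  }

≤∞-refl : ∀ {x} → x ≤∞ x
≤∞-refl {fin p} = fin≤fin ℚP.≤-refl
≤∞-refl {∞}     = ∞ ≤∞∞

≤∞-trans : ∀ {x y z} → x ≤∞ y → y ≤∞ z → x ≤∞ z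
≤∞-trans (fin≤fin p≤q) (fin≤fin q≤r) = fin≤fin (ℚP.≤-trans p≤q q≤r)
≤∞-trans _             (_ ≤∞∞)       = _ ≤∞∞

≤∞-reflexive : ∀ {x y} → x ≡ y → x ≤∞ y
≤∞-reflexive refl = ≤∞-refl

≤∞-isPreorder : IsPreorder _≡_ _≤∞_
≤∞-isPreorder = record { isEquivalence = isEquivalence ; reflexive = ≤∞-reflexive ; trans = ≤∞-trans }

≤∞-preorder : Preorder 0ℓ 0ℓ 0ℓ
≤∞-preorder = record { isPreorder = ≤∞-isPreorder }

module ≤∞-Reasoning = Relation.Binary.Reasoning.Preorder ≤∞-preorder

x+∞∞≡∞ : ∀ x → x +∞ ∞ ≡ ∞
x+∞∞≡∞ (fin p) = refl
x+∞∞≡∞ ∞       = refl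

+∞-mono-≤∞ : _+∞_ Preserves₂ _≤∞_ ⟶ _≤∞_ ⟶ _≤∞_
+∞-mono-≤∞ (fin≤fin p≤q) (fin≤fin r≤s) = fin≤fin (ℚP.+-mono-≤ p≤q r≤s)
+∞-mono-≤∞ {y = y} _     (_ ≤∞∞)       = subst (_ ≤∞_) (sym (x+∞∞≡∞ y)) (_ ≤∞∞)
+∞-mono-≤∞ (_ ≤∞∞)       (fin≤fin _)   = _ ≤∞∞

-- Σℚ.Σ[ a , b ] and Σ∞.Σ[ a , b ] unfold to sumR a b and sumR∞ a b.
module Σℚ = RangeSums ℚ._+_ 0ℚ ℚ._≤_ ℚP.+-0-isCommutativeMonoid ℚP.≤-isPreorder ℚP.+-mono-≤
  sumN (λ _ → refl) (λ _ _ → refl) sumFin (λ _ → refl) (λ _ → refl)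
module Σ∞ = RangeSums _+∞_ (fin 0ℚ) _≤∞_ +∞-0-isCommutativeMonoid ≤∞-isPreorder +∞-mono-≤∞
  sumN∞ (λ _ → refl) (λ _ _ → refl) sumFin∞ (λ _ → refl) (λ _ → refl)

sumFin-fromℕ : ∀ {n} (x : Fin n → ℕ) → sumFin (λ i → fromℕ (x i)) ≡ fromℕ (sumFinℕ x)
sumFin-fromℕ {zero}  x = refl
sumFin-fromℕ {suc n} x =
  trans (cong (fromℕ (x zero) ℚ.+_) (sumFin-fromℕ (λ i → x (suc i)))) (sym (fromℕ-+ (x zero) _))

Nonneg∞ : ℚ∞ → Set
Nonneg∞ x = fin 0ℚ ≤∞ x

x≤∞x+∞y : ∀ x {y} → Nonneg∞ y → x ≤∞ x +∞ y
x≤∞x+∞y x 0≤y = subst (_≤∞ x +∞ _) (+∞-identityʳ x) (+∞-mono-≤∞ ≤∞-refl 0≤y)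

x≤∞double : ∀ {x} → Nonneg∞ x → x ≤∞ double x
x≤∞double {x} 0≤x = x≤∞x+∞y x 0≤x

double-mono : ∀ {x y} → x ≤∞ y → double x ≤∞ double y
double-mono x≤y = +∞-mono-≤∞ x≤y x≤y

double-+ : ∀ x y → double (x +∞ y) ≡ double x +∞ double y
double-+ x y = Σ∞.interchange x y x y

-∞-nonneg : ∀ {x y} → x ≤∞ y → Nonneg∞ (y -∞ x)
-∞-nonneg {fin p} {fin q} (fin≤fin p≤q) =
  fin≤fin (subst (ℚ._≤ q ℚ.- p) (ℚP.+-inverseʳ p) (ℚP.+-monoˡ-≤ (ℚ.- p) p≤q))
-∞-nonneg {fin p} {∞}     _             = _ ≤∞∞
-∞-nonneg {∞}     {∞}     _             = _ ≤∞∞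

+∞-[-∞] : ∀ {x y} → x ≤∞ y → x +∞ (y -∞ x) ≡ y
+∞-[-∞] {fin p} {fin q} _ = cong fin (trans (ℚP.+-comm p (q ℚ.- p)) (ℚ+.//-rightDividesˡ p q))
+∞-[-∞] {fin p} {∞}     _ = refl
+∞-[-∞] {∞}     {∞}     _ = refl

scale-1 : ∀ g → scale g 1ℚ ≡ g
scale-1 (fin p) = cong fin (ℚP.*-identityʳ p)
scale-1 ∞       = refl

scale-0 : ∀ g → scale g 0ℚ ≡ fin 0ℚ
scale-0 (fin p) = cong fin (ℚP.*-zeroʳ p)
scale-0 ∞       = refl

scale-nonneg : ∀ {g q} → Nonneg∞ g → 0ℚ ℚ.≤ q → Nonneg∞ (scale g q)
scale-nonneg {fin p} {q} (fin≤fin 0≤p) 0≤q = fin≤fin (ℚP.nonNegative⁻¹ (p ℚ.* q)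
  {{ℚP.nonNeg*nonNeg⇒nonNeg p {{ℚ.nonNegative 0≤p}} q {{ℚ.nonNegative 0≤q}}}})
scale-nonneg {∞} {q} _ _ with q ℚ.≟ 0ℚ
... | yes _ = ≤∞-refl
... | no  _ = _ ≤∞∞

scale-double : ∀ g q → scale g (q ℚ.+ q) ≤∞ double (scale g q)
scale-double (fin p) q = fin≤fin (ℚP.≤-reflexive (ℚP.*-distribˡ-+ p q q))
scale-double ∞ q with q ℚ.≟ 0ℚ
... | yes refl = ≤∞-refl
... | no  _    = _ ≤∞∞

-- ½ ≤ q rules out the convention scale ∞ 0ℚ = fin 0ℚ.
≤∞-double-scale : ∀ {g q} → Nonneg∞ g → ½ ℚ.≤ q → g ≤∞ double (scale g q)
≤∞-double-scale {fin p} {q} (fin≤fin 0≤p) ½≤q = fin≤fin (begin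
  p                 ≡⟨ sym (ℚP.*-identityʳ p) ⟩
  p ℚ.* 1ℚ          ≤⟨ ℚP.*-monoˡ-≤-nonNeg p {{ℚ.nonNegative 0≤p}} (ℚP.+-mono-≤ ½≤q ½≤q) ⟩
  p ℚ.* (q ℚ.+ q)   ≡⟨ ℚP.*-distribˡ-+ p q q ⟩
  p ℚ.* q ℚ.+ p ℚ.* q ∎)
  where open ℚP.≤-Reasoning
≤∞-double-scale {∞} {q} _ ½≤q with q ℚ.≟ 0ℚ
... | yes refl = ⊥-elim (½≰0 ½≤q)
... | no  _    = ≤∞-refl

sumFin∞-sumR∞-≤double : ∀ {n} (l u : Fin n → ℕ) (h h' : Fin n → ℕ → ℚ∞) →
  (∀ i j → l i ℕ.< j → j ℕ.≤ u i → h i j ≤∞ double (h' i j)) →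
  sumFin∞ (λ i → sumR∞ (l i) (u i) (h i)) ≤∞ double (sumFin∞ (λ i → sumR∞ (l i) (u i) (h' i)))
sumFin∞-sumR∞-≤double l u h h' le = begin
  sumFin∞ (λ i → sumR∞ (l i) (u i) (h i))
    ≲⟨ Σ∞.ΣFin-mono (λ i → Σ∞.Σ-mono (l i) (u i) (le i)) ⟩
  sumFin∞ (λ i → sumR∞ (l i) (u i) (λ j → double (h' i j)))
    ≡⟨ Σ∞.ΣFin-cong (λ i → Σ∞.Σ-⊕ (l i) (u i) (h' i) (h' i)) ⟩
  sumFin∞ (λ i → double (sumR∞ (l i) (u i) (h' i)))
    ≡⟨ Σ∞.ΣFin-⊕ (λ i → sumR∞ (l i) (u i) (h' i)) (λ i → sumR∞ (l i) (u i) (h' i)) ⟩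
  double (sumFin∞ (λ i → sumR∞ (l i) (u i) (h' i))) ∎
  where open ≤∞-Reasoning

if-elim : ∀ {A : Set} (P : A → Set) b {x y : A} → (b ≡ true → P x) → (b ≡ false → P y) → P (if b then x else y)
if-elim P true  Px _  = Px refl
if-elim P false _  Py = Py refl

step : ℕ → ℕ → ℚ
step x j = if j ≤ᵇ x then 1ℚ else 0ℚ

step≡1 : ∀ {x j} → j ℕ.≤ x → step x j ≡ 1ℚ
step≡1 {x} {j} j≤x with j ≤ᵇ x | ℕP.≤⇒≤ᵇ j≤x
... | true | _ = refl

step≡0 : ∀ {x j} → x ℕ.< j → step x j ≡ 0ℚ
step≡0 {x} {j} x<j with j ≤ᵇ x | ℕP.≤ᵇ⇒≤ j x
... | false | _   = refl
... | true  | j≤x = ⊥-elim (ℕP.<⇒≱ x<j (j≤x tt))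

step-nonneg : ∀ x j → 0ℚ ℚ.≤ step x j
step-nonneg x j with j ≤ᵇ x
... | true  = 0≤1
... | false = ℚP.≤-refl

step-antitone : ∀ x j → step x (suc j) ℚ.≤ step x j
step-antitone x j with ℕP.≤-<-connex (suc j) x
... | inj₁ j<x = ℚP.≤-reflexive (trans (step≡1 j<x) (sym (step≡1 (ℕP.<⇒≤ j<x))))
... | inj₂ x<j = subst (ℚ._≤ step x j) (sym (step≡0 x<j)) (step-nonneg x j)

sumR-step : ∀ x a b → sumR a b (step x) ≡ fromℕ ((b ∸ a) ⊓ (x ∸ a))
sumR-step x a b = count (b ∸ a)
  where
  count : ∀ k → sumN k (λ t → step x (a ℕ.+ suc t)) ≡ fromℕ (k ⊓ (x ∸ a))
  count zero = refl
  count (suc k) with ℕP.≤-<-connex (a ℕ.+ suc k) x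
  ... | inj₁ a+k<x = begin
    sumN k _ ℚ.+ step x (a ℕ.+ suc k) ≡⟨ cong₂ ℚ._+_ (count k) (step≡1 a+k<x) ⟩
    fromℕ (k ⊓ (x ∸ a)) ℚ.+ 1ℚ        ≡⟨ cong (λ l → fromℕ l ℚ.+ 1ℚ) (ℕP.m≤n⇒m⊓n≡m (ℕP.<⇒≤ k<x∸a)) ⟩
    fromℕ k ℚ.+ fromℕ 1               ≡⟨ sym (fromℕ-+ k 1) ⟩
    fromℕ (k ℕ.+ 1)                   ≡⟨ cong fromℕ (trans (ℕP.+-comm k 1) (sym (ℕP.m≤n⇒m⊓n≡m k<x∸a))) ⟩
    fromℕ (suc k ⊓ (x ∸ a))           ∎
    where
    open ≡-Reasoning
    k<x∸a : k ℕ.< x ∸ a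
    k<x∸a = ℕP.m+n≤o⇒m≤o∸n (suc k) (subst (ℕ._≤ x) (ℕP.+-comm a (suc k)) a+k<x)
  ... | inj₂ x<a+k = begin
    sumN k _ ℚ.+ step x (a ℕ.+ suc k) ≡⟨ cong₂ ℚ._+_ (count k) (step≡0 x<a+k) ⟩
    fromℕ (k ⊓ (x ∸ a)) ℚ.+ 0ℚ        ≡⟨ ℚP.+-identityʳ _ ⟩
    fromℕ (k ⊓ (x ∸ a))               ≡⟨ cong fromℕ (trans (ℕP.m≥n⇒m⊓n≡n x∸a≤k) (sym (ℕP.m≥n⇒m⊓n≡n (ℕP.m≤n⇒m≤1+n x∸a≤k)))) ⟩
    fromℕ (suc k ⊓ (x ∸ a))           ∎
    where
    open ≡-Reasoning
    x∸a≤k : x ∸ a ℕ.≤ k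
    x∸a≤k = ℕP.m≤n+o⇒m∸n≤o x a (ℕP.≤-pred (subst (suc x ℕ.≤_) (ℕP.+-suc a k) x<a+k))

stepVars : ∀ {n} → (Fin n → ℕ) → Vars n
stepVars x i = step (x i)

AntitoneOn : ℕ → (ℕ → ℚ) → Set
AntitoneOn m h = ∀ j → 1 ℕ.≤ j → j ℕ.< m → h (suc j) ℚ.≤ h j

antitone-≤ : ∀ {m h} → AntitoneOn m h → ∀ {j l} → 1 ℕ.≤ j → j ℕ.≤ l → l ℕ.≤ m → h l ℚ.≤ h j
antitone-≤ anti {j} {zero} 1≤j j≤l _ = ⊥-elim (ℕP.<⇒≱ 1≤j j≤l)
antitone-≤ anti {j} {suc l} 1≤j j≤l l<m with ℕP.m≤n⇒m<n∨m≡n j≤l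
... | inj₂ refl = ℚP.≤-refl
... | inj₁ j<l  = ℚP.≤-trans (anti l (ℕP.≤-trans 1≤j (ℕP.≤-pred j<l)) l<m)
                    (antitone-≤ anti 1≤j (ℕP.≤-pred j<l) (ℕP.<⇒≤ l<m))

minUpTo-cong : ∀ {h h'} j → (∀ l → 1 ℕ.≤ l → l ℕ.≤ j → h l ≡ h' l) → minUpTo h j ≡ minUpTo h' j
minUpTo-cong zero          _  = refl
minUpTo-cong (suc zero)    eq = eq 1 ℕP.≤-refl ℕP.≤-refl
minUpTo-cong (suc (suc j)) eq = cong₂ ℚ._⊓_ (eq (suc (suc j)) (s≤s z≤n) ℕP.≤-refl)
  (minUpTo-cong (suc j) (λ l 1≤l l≤j → eq l 1≤l (ℕP.m≤n⇒m≤1+n l≤j)))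

minUpTo-antitone : ∀ {m h} → AntitoneOn m h → ∀ j → 1 ℕ.≤ j → j ℕ.≤ m → minUpTo h j ≡ h j
minUpTo-antitone anti (suc zero)    _ _   = refl
minUpTo-antitone {h = h} anti (suc (suc j)) _ j<m =
  trans (cong (h (suc (suc j)) ℚ.⊓_) (minUpTo-antitone anti (suc j) (s≤s z≤n) (ℕP.<⇒≤ j<m)))
        (ℚP.p≤q⇒p⊓q≡p (anti (suc j) (s≤s z≤n) j<m))

minUpTo-step : ∀ x j → 1 ℕ.≤ j → minUpTo (step x) j ≡ step x j
minUpTo-step x j 1≤j = minUpTo-antitone {m = j} (λ l _ _ → step-antitone x l) j 1≤j ℕP.≤-refl

lastHalf≤ : ∀ h m → lastHalf h m ℕ.≤ m
lastHalf≤ h zero    = z≤n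
lastHalf≤ h (suc m) with ½ ℚ.≤ᵇ h (suc m)
... | true  = ℕP.≤-refl
... | false = ℕP.m≤n⇒m≤1+n (lastHalf≤ h m)

lastHalf<⇒<½ : ∀ h m {j} → lastHalf h m ℕ.< j → j ℕ.≤ m → h j ℚ.< ½
lastHalf<⇒<½ h zero    L<j j≤m = ⊥-elim (ℕP.<⇒≱ L<j j≤m)
lastHalf<⇒<½ h (suc m) L<j j≤m with ½ ℚ.≤ᵇ h (suc m) in eq | ℕP.m≤n⇒m<n∨m≡n j≤m
... | true  | _         = ⊥-elim (ℕP.<⇒≱ L<j j≤m)
... | false | inj₂ refl = ℚP.≰⇒> (λ ½≤h → subst T eq (ℚP.≤⇒≤ᵇ ½≤h))
... | false | inj₁ j≤m' = lastHalf<⇒<½ h m L<j (ℕP.≤-pred j≤m')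

½≤lastHalf : ∀ h m → 1 ℕ.≤ lastHalf h m → ½ ℚ.≤ h (lastHalf h m)
½≤lastHalf h (suc m) 1≤L with ½ ℚ.≤ᵇ h (suc m) in eq
... | true  = ℚP.≤ᵇ⇒≤ (subst T (sym eq) tt)
... | false = ½≤lastHalf h m 1≤L

≤lastHalf⇒½≤ : ∀ {h m} → AntitoneOn m h → ∀ {j} → 1 ℕ.≤ j → j ℕ.≤ lastHalf h m → ½ ℚ.≤ h j
≤lastHalf⇒½≤ {h} {m} anti 1≤j j≤L =
  ℚP.≤-trans (½≤lastHalf h m (ℕP.≤-trans 1≤j j≤L)) (antitone-≤ anti 1≤j j≤L (lastHalf≤ h m))

integral-½≤ : ∀ {q} → IsIntegral q → ½ ℚ.≤ q → q ≡ 1ℚ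
integral-½≤ (inj₁ refl) ½≤0 = ⊥-elim (½≰0 ½≤0)
integral-½≤ (inj₂ q≡1)  _   = q≡1

integral-<½ : ∀ {q} → IsIntegral q → q ℚ.< ½ → q ≡ 0ℚ
integral-<½ (inj₁ q≡0)  _   = q≡0
integral-<½ (inj₂ refl) 1<½ = ⊥-elim (ℚP.<-irrefl refl (ℚP.<-≤-trans 1<½ (ℚP.≤ᵇ⇒≤ tt)))

integral-antitone⇒step : ∀ {m h} → AntitoneOn m h → (∀ j → 1 ℕ.≤ j → j ℕ.≤ m → IsIntegral (h j)) →
  ∀ j → 1 ℕ.≤ j → j ℕ.≤ m → h j ≡ step (lastHalf h m) j
integral-antitone⇒step {m} {h} anti int j 1≤j j≤m with ℕP.≤-<-connex j (lastHalf h m)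
... | inj₁ j≤L = trans (integral-½≤ (int j 1≤j j≤m) (≤lastHalf⇒½≤ anti 1≤j j≤L)) (sym (step≡1 j≤L))
... | inj₂ L<j = trans (integral-<½ (int j 1≤j j≤m) (lastHalf<⇒<½ h m L<j j≤m)) (sym (step≡0 L<j))

mof≤m : ∀ {n} D m (a : Fin n → ℕ) i → mof D m a i ℕ.≤ m
mof≤m D m a i = ℕP.m⊓n≤m m _

GKCFeasible-step : ∀ {n D m} (x : Fin n → ℕ) → NLKCFeasible D m x → GKCFeasible D m (stepVars x)
GKCFeasible-step {n} {D} {m} x (x≤m , D≤Σx) = (λ i j _ _ → step-nonneg (x i) j) , cover
  where
  cover : ∀ a → (∀ i → a i ℕ.≤ m) →
    fromℕ (Dof D a) ℚ.≤ sumFin (λ i → sumR (a i) (mof D m a i) (minUpTo (step (x i))))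
  cover a _ = begin
    fromℕ d                                             ≤⟨ fromℕ-mono-≤ d≤Σ ⟩
    fromℕ (sumFinℕ (λ i → d ⊓ (x i ∸ a i)))             ≡⟨ sym (sumFin-fromℕ (λ i → d ⊓ (x i ∸ a i))) ⟩
    sumFin (λ i → fromℕ (d ⊓ (x i ∸ a i)))              ≤⟨ Σℚ.ΣFin-mono (λ i → fromℕ-mono-≤ (⊓-∸-≤ (a i) d (x≤m i))) ⟩
    sumFin (λ i → fromℕ ((mof D m a i ∸ a i) ⊓ (x i ∸ a i)))
      ≡⟨ Σℚ.ΣFin-cong (λ i → sym (sumR-step (x i) (a i) (mof D m a i))) ⟩
    sumFin (λ i → sumR (a i) (mof D m a i) (step (x i)))
      ≡⟨ Σℚ.ΣFin-cong (λ i → Σℚ.Σ-cong (a i) _ (λ j a<j _ →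
           sym (minUpTo-step (x i) j (ℕP.m<n⇒0<n a<j)))) ⟩
    sumFin (λ i → sumR (a i) (mof D m a i) (minUpTo (step (x i)))) ∎
    where
    open ℚP.≤-Reasoning
    d = Dof D a
    d≤Σ : d ℕ.≤ sumFinℕ (λ i → d ⊓ (x i ∸ a i))
    d≤Σ = ℕP.≤-trans
      (ℕP.≤-reflexive (sym (ℕP.m≤n⇒m⊓n≡m (ℕP.≤-trans (ℕP.∸-monoˡ-≤ (sumFinℕ a) D≤Σx) (sumFinℕ-∸ x a)))))
      (⊓-sumFinℕ-≤ d (λ i → x i ∸ a i))

GKCFeasible-cong : ∀ {n D m} {z z' : Vars n} → (∀ i j → 1 ℕ.≤ j → j ℕ.≤ m → z i j ≡ z' i j) →
  GKCFeasible D m z → GKCFeasible D m z'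
GKCFeasible-cong {D = D} {m} eq (nonneg , cover) =
    (λ i j 1≤j j≤m → subst (0ℚ ℚ.≤_) (eq i j 1≤j j≤m) (nonneg i j 1≤j j≤m))
  , λ a a≤m → ℚP.≤-trans (cover a a≤m) (ℚP.≤-reflexive (Σℚ.ΣFin-cong (λ i →
      Σℚ.Σ-cong (a i) (mof D m a i) (λ j _ j≤mof → minUpTo-cong j (λ l 1≤l l≤j →
        eq i l 1≤l (ℕP.≤-trans l≤j (ℕP.≤-trans j≤mof (mof≤m D m a i))))))))

telescope : ∀ (φ : ℕ → ℚ∞) x → (∀ j → j ℕ.< x → φ j ≤∞ φ (suc j)) →
  φ 0 +∞ sumR∞ 0 x (λ j → φ j -∞ φ (j ∸ 1)) ≡ φ x
telescope φ zero    _    = +∞-identityʳ (φ 0)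
telescope φ (suc x) mono = begin
  φ 0 +∞ (sumR∞ 0 x Δφ +∞ Δφ (suc x)) ≡⟨ sym (+∞-assoc _ _ _) ⟩
  (φ 0 +∞ sumR∞ 0 x Δφ) +∞ Δφ (suc x) ≡⟨ cong (_+∞ Δφ (suc x)) (telescope φ x (λ j j<x → mono j (ℕP.m≤n⇒m≤1+n j<x))) ⟩
  φ x +∞ (φ (suc x) -∞ φ x)           ≡⟨ +∞-[-∞] (mono x ℕP.≤-refl) ⟩
  φ (suc x)                           ∎
  where
  open ≡-Reasoning
  Δφ : ℕ → ℚ∞
  Δφ j = φ j -∞ φ (j ∸ 1)

sumR∞-scale-step : ∀ (g : ℕ → ℚ∞) {x m} → x ℕ.≤ m →
  sumR∞ 0 m (λ j → scale (g j) (step x j)) ≡ sumR∞ 0 x g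
sumR∞-scale-step g {x} {m} x≤m = begin
  sumR∞ 0 m gz                    ≡⟨ Σ∞.Σ-split gz z≤n x≤m ⟩
  sumR∞ 0 x gz +∞ sumR∞ x m gz    ≡⟨ cong₂ _+∞_ (Σ∞.Σ-cong 0 x (λ j _ j≤x → trans (cong (scale (g j)) (step≡1 j≤x)) (scale-1 (g j))))
                                                (Σ∞.Σ-ε x m (λ j x<j _ → trans (cong (scale (g j)) (step≡0 x<j)) (scale-0 (g j)))) ⟩
  sumR∞ 0 x g +∞ fin 0ℚ          ≡⟨ +∞-identityʳ _ ⟩
  sumR∞ 0 x g                     ∎
  where
  open ≡-Reasoning
  gz : ℕ → ℚ∞
  gz j = scale (g j) (step x j)

costG-cong : ∀ {n} m f {z z' : Vars n} → (∀ i j → 1 ℕ.≤ j → j ℕ.≤ m → z i j ≡ z' i j) →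
  costG m f z ≡ costG m f z'
costG-cong m f eq = Σ∞.ΣFin-cong (λ i → Σ∞.Σ-cong 0 m (λ j 0<j j≤m → cong (scale (gcoef f i j)) (eq i j 0<j j≤m)))

costF-step : ∀ {n m} (f : Fin n → ℕ → ℚ∞) → (∀ i j → j ℕ.< m → f i j ≤∞ f i (suc j)) →
  ∀ x → (∀ i → x i ℕ.≤ m) → costF f x ≡ sumFin∞ (λ i → f i 0) +∞ costG m f (stepVars x)
costF-step {m = m} f f-mono x x≤m = begin
  sumFin∞ (λ i → f i (x i))
    ≡⟨ Σ∞.ΣFin-cong (λ i → sym (telescope (f i) (x i) (λ j j<x → f-mono i j (ℕP.<-≤-trans j<x (x≤m i))))) ⟩
  sumFin∞ (λ i → f i 0 +∞ sumR∞ 0 (x i) (gcoef f i))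
    ≡⟨ Σ∞.ΣFin-⊕ (λ i → f i 0) (λ i → sumR∞ 0 (x i) (gcoef f i)) ⟩
  sumFin∞ (λ i → f i 0) +∞ sumFin∞ (λ i → sumR∞ 0 (x i) (gcoef f i))
    ≡⟨ cong (_ +∞_) (Σ∞.ΣFin-cong (λ i → sym (sumR∞-scale-step (gcoef f i) (x≤m i)))) ⟩
  sumFin∞ (λ i → f i 0) +∞ costG m f (stepVars x) ∎
  where open ≡-Reasoning

FracItem-integral : ∀ {n D m a z} (k : Maybe (Fin n)) → FracItem D m a z k →
  ∀ i → isItem k i ≡ false → ∀ j → InR D m a i j → IsIntegral (z i j)
FracItem-integral nothing   integral       i _ = integral i
FracItem-integral (just k₀) (_ , integral) i not-k with k₀ ≟F i
FracItem-integral (just k₀) (_ , integral) i () | yes _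
... | no k₀≢i = integral i (λ i≡k₀ → k₀≢i (sym i≡k₀))

sumFin-≤-except : ∀ {n} (k : Maybe (Fin n)) (h g : Fin n → ℚ) {c} → 0ℚ ℚ.≤ c →
  (∀ i → isItem k i ≡ false → h i ℚ.≤ g i) → (∀ i → h i ℚ.≤ g i ℚ.+ c) → sumFin h ℚ.≤ sumFin g ℚ.+ c
sumFin-≤-except nothing h g {c} 0≤c h≤g _ = ℚP.≤-trans (Σℚ.ΣFin-mono (λ i → h≤g i refl))
  (subst (ℚ._≤ sumFin g ℚ.+ c) (ℚP.+-identityʳ (sumFin g)) (ℚP.+-monoʳ-≤ (sumFin g) 0≤c))
sumFin-≤-except (just k₀) h g {c} _ h≤g h≤g+c = Σℚ.ΣFin-mono-except k₀ h g c
  (λ i i≢k₀ → h≤g i (not-k₀ i i≢k₀)) (h≤g+c k₀)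
  where
  not-k₀ : ∀ i → ¬ i ≡ k₀ → isItem (just k₀) i ≡ false
  not-k₀ i i≢k₀ with k₀ ≟F i
  ... | yes k₀≡i = ⊥-elim (i≢k₀ (sym k₀≡i))
  ... | no  _    = refl

module Rounding
  {n D m : ℕ} (ā : Fin n → ℕ) (ā≤m : ∀ i → ā i ℕ.≤ m)
  (z* : Vars n) (z*-feasible : RFeasible D m ā z*)
  (k : Maybe (Fin n)) (z*-frac : FracItem D m ā z* k)
  where

  D̄ : ℕ
  D̄ = Dof D ā

  m̄ : Fin n → ℕ
  m̄ = mof D m ā

  ẑ : Vars n
  ẑ = zhat D m ā z* k

  ā≤m̄ : ∀ i → ā i ℕ.≤ m̄ i
  ā≤m̄ i = ℕP.⊓-glb (ā≤m i) (ℕP.m≤m+n (ā i) D̄)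

  m̄≤m : ∀ i → m̄ i ℕ.≤ m
  m̄≤m = mof≤m D m ā

  m̄∸ā≤D̄ : ∀ i → m̄ i ∸ ā i ℕ.≤ D̄
  m̄∸ā≤D̄ i = ℕP.m≤n+o⇒m∸n≤o (m̄ i) (ā i) (ℕP.m⊓n≤n m (ā i ℕ.+ D̄))

  z*-bounds : ∀ i j → InR D m ā i j → 0ℚ ℚ.≤ z* i j × z* i j ℚ.≤ 1ℚ
  z*-bounds = proj₁ (proj₂ z*-feasible)

  z*-antitone : ∀ i j → InR D m ā i j → InR D m ā i (suc j) → z* i (suc j) ℚ.≤ z* i j
  z*-antitone = proj₂ (proj₂ z*-feasible)

  z*-integral : ∀ i → isItem k i ≡ false → ∀ j → InR D m ā i j → IsIntegral (z* i j)
  z*-integral = FracItem-integral k z*-frac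

  ẑ-≤ā : ∀ {i j} → j ℕ.≤ ā i → ẑ i j ≡ 1ℚ
  ẑ-≤ā {i} {j} j≤ā with j ≤ᵇ ā i | ℕP.≤⇒≤ᵇ j≤ā
  ... | true | _ = refl

  ẑ-inR : ∀ {i j} → InR D m ā i j → ẑ i j ≡ (if isItem k i then 0ℚ else z* i j)
  ẑ-inR {i} {j} (ā<j , j≤m̄) with j ≤ᵇ ā i | ℕP.≤ᵇ⇒≤ j (ā i) | j ≤ᵇ m̄ i | ℕP.≤⇒≤ᵇ j≤m̄
  ... | true  | j≤ā | _    | _ = ⊥-elim (ℕP.<⇒≱ ā<j (j≤ā tt))
  ... | false | _   | true | _ = if-not (isItem k i)

  ẑ->m̄ : ∀ {i j} → m̄ i ℕ.< j → ẑ i j ≡ 0ℚ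
  ẑ->m̄ {i} {j} m̄<j with j ≤ᵇ ā i | ℕP.≤ᵇ⇒≤ j (ā i) | j ≤ᵇ m̄ i | ℕP.≤ᵇ⇒≤ j (m̄ i)
  ... | true  | j≤ā | _     | _   = ⊥-elim (ℕP.<⇒≱ m̄<j (ℕP.≤-trans (j≤ā tt) (ā≤m̄ i)))
  ... | false | _   | true  | j≤m̄ = ⊥-elim (ℕP.<⇒≱ m̄<j (j≤m̄ tt))
  ... | false | _   | false | _   = refl

  ẑ-integral : ∀ i j → 1 ℕ.≤ j → j ℕ.≤ m → IsIntegral (ẑ i j)
  ẑ-integral i j _ _ with ℕP.≤-<-connex j (ā i) | ℕP.≤-<-connex j (m̄ i)
  ... | inj₁ j≤ā | _        = inj₂ (ẑ-≤ā j≤ā)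
  ... | inj₂ _   | inj₂ m̄<j = inj₁ (ẑ->m̄ m̄<j)
  ... | inj₂ ā<j | inj₁ j≤m̄ = subst IsIntegral (sym (ẑ-inR (ā<j , j≤m̄)))
    (if-elim IsIntegral (isItem k i) (λ _ → inj₁ refl) (λ not-k → z*-integral i not-k j (ā<j , j≤m̄)))

  ẑ-nonneg : ∀ i j → 1 ℕ.≤ j → j ℕ.≤ m → 0ℚ ℚ.≤ ẑ i j
  ẑ-nonneg i j 1≤j j≤m with ẑ-integral i j 1≤j j≤m
  ... | inj₁ ẑ≡0 = ℚP.≤-reflexive (sym ẑ≡0)
  ... | inj₂ ẑ≡1 = subst (0ℚ ℚ.≤_) (sym ẑ≡1) 0≤1

  ẑ-antitone : ∀ i → AntitoneOn m (ẑ i)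
  ẑ-antitone i j 1≤j j<m with ℕP.≤-<-connex (suc j) (ā i) | ℕP.≤-<-connex (suc j) (m̄ i)
  ... | inj₁ j<ā | _         = ℚP.≤-reflexive (trans (ẑ-≤ā j<ā) (sym (ẑ-≤ā (ℕP.<⇒≤ j<ā))))
  ... | inj₂ _   | inj₂ m̄<sj = subst (ℚ._≤ ẑ i j) (sym (ẑ->m̄ m̄<sj)) (ẑ-nonneg i j 1≤j (ℕP.<⇒≤ j<m))
  ... | inj₂ ā<sj | inj₁ sj≤m̄ with ℕP.≤-<-connex j (ā i)
  ...   | inj₁ j≤ā = subst₂ ℚ._≤_ (sym (ẑ-inR (ā<sj , sj≤m̄))) (sym (ẑ-≤ā j≤ā)) mid≤1
    where
    mid≤1 : (if isItem k i then 0ℚ else z* i (suc j)) ℚ.≤ 1ℚ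
    mid≤1 = if-elim (ℚ._≤ 1ℚ) (isItem k i) (λ _ → 0≤1) (λ _ → proj₂ (z*-bounds i (suc j) (ā<sj , sj≤m̄)))
  ...   | inj₂ ā<j = subst₂ ℚ._≤_ (sym (ẑ-inR (ā<sj , sj≤m̄))) (sym (ẑ-inR (ā<j , j≤m̄))) mid-antitone
    where
    j≤m̄ : j ℕ.≤ m̄ i
    j≤m̄ = ℕP.<⇒≤ sj≤m̄
    mid-antitone : (if isItem k i then 0ℚ else z* i (suc j)) ℚ.≤ (if isItem k i then 0ℚ else z* i j)
    mid-antitone with isItem k i
    ... | true  = ℚP.≤-refl
    ... | false = z*-antitone i j (ā<j , j≤m̄) (ā<sj , sj≤m̄)

  x̂ : Fin n → ℕ
  x̂ i = lastHalf (ẑ i) m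

  x̂≤m : ∀ i → x̂ i ℕ.≤ m
  x̂≤m i = lastHalf≤ (ẑ i) m

  ẑ≡step : ∀ i j → 1 ℕ.≤ j → j ℕ.≤ m → ẑ i j ≡ stepVars x̂ i j
  ẑ≡step i = integral-antitone⇒step (ẑ-antitone i) (ẑ-integral i)

  ā≤x̂ : ∀ i → ā i ℕ.≤ x̂ i
  ā≤x̂ i with ℕP.≤-<-connex (ā i) (x̂ i)
  ... | inj₁ ā≤x̂ = ā≤x̂
  ... | inj₂ x̂<ā = ⊥-elim (1ℚ≢0ℚ (begin
    1ℚ                 ≡⟨ sym (ẑ-≤ā ℕP.≤-refl) ⟩
    ẑ i (ā i)          ≡⟨ ẑ≡step i (ā i) (ℕP.m<n⇒0<n x̂<ā) (ā≤m i) ⟩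
    step (x̂ i) (ā i)   ≡⟨ step≡0 x̂<ā ⟩
    0ℚ                 ∎))
    where
    open ≡-Reasoning
    1ℚ≢0ℚ : ¬ 1ℚ ≡ 0ℚ
    1ℚ≢0ℚ ()

  z*-mass ẑ-mass : Fin n → ℚ
  z*-mass i = sumR (ā i) (m̄ i) (z* i)
  ẑ-mass i = sumR (ā i) (m̄ i) (ẑ i)

  ā+ẑ-mass≤x̂ : ∀ i → fromℕ (ā i) ℚ.+ ẑ-mass i ℚ.≤ fromℕ (x̂ i)
  ā+ẑ-mass≤x̂ i = begin
    fromℕ (ā i) ℚ.+ ẑ-mass i
      ≡⟨ cong (fromℕ (ā i) ℚ.+_) (trans (Σℚ.Σ-cong (ā i) (m̄ i) (λ j ā<j j≤m̄ →
           ẑ≡step i j (ℕP.m<n⇒0<n ā<j) (ℕP.≤-trans j≤m̄ (m̄≤m i)))) (sumR-step (x̂ i) (ā i) (m̄ i))) ⟩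
    fromℕ (ā i) ℚ.+ fromℕ ((m̄ i ∸ ā i) ⊓ (x̂ i ∸ ā i))
      ≤⟨ ℚP.+-monoʳ-≤ (fromℕ (ā i)) (fromℕ-mono-≤ (ℕP.m⊓n≤n (m̄ i ∸ ā i) (x̂ i ∸ ā i))) ⟩
    fromℕ (ā i) ℚ.+ fromℕ (x̂ i ∸ ā i)
      ≡⟨ sym (fromℕ-+ (ā i) (x̂ i ∸ ā i)) ⟩
    fromℕ (ā i ℕ.+ (x̂ i ∸ ā i))
      ≡⟨ cong fromℕ (ℕP.m+[n∸m]≡n (ā≤x̂ i)) ⟩
    fromℕ (x̂ i) ∎
    where open ℚP.≤-Reasoning

  z*-mass≡ẑ-mass : ∀ i → isItem k i ≡ false → z*-mass i ≡ ẑ-mass i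
  z*-mass≡ẑ-mass i not-k = Σℚ.Σ-cong (ā i) (m̄ i) (λ j ā<j j≤m̄ →
    sym (trans (ẑ-inR (ā<j , j≤m̄)) (cong (if_then 0ℚ else z* i j) not-k)))

  z*-mass≤ẑ-mass+D̄ : ∀ i → z*-mass i ℚ.≤ ẑ-mass i ℚ.+ fromℕ D̄
  z*-mass≤ẑ-mass+D̄ i = begin
    z*-mass i                         ≤⟨ Σℚ.Σ-mono (ā i) (m̄ i) (λ j ā<j j≤m̄ →
                                           subst (z* i j ℚ.≤_) (sym (step≡1 j≤m̄)) (proj₂ (z*-bounds i j (ā<j , j≤m̄)))) ⟩
    sumR (ā i) (m̄ i) (step (m̄ i))     ≡⟨ trans (sumR-step (m̄ i) (ā i) (m̄ i)) (cong fromℕ (ℕP.⊓-idem (m̄ i ∸ ā i))) ⟩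
    fromℕ (m̄ i ∸ ā i)                 ≤⟨ fromℕ-mono-≤ (m̄∸ā≤D̄ i) ⟩
    fromℕ D̄                           ≡⟨ sym (ℚP.+-identityˡ _) ⟩
    0ℚ ℚ.+ fromℕ D̄                    ≤⟨ ℚP.+-monoˡ-≤ (fromℕ D̄) (Σℚ.Σ-nonneg (ā i) (m̄ i) (λ j ā<j j≤m̄ →
                                           ẑ-nonneg i j (ℕP.m<n⇒0<n ā<j) (ℕP.≤-trans j≤m̄ (m̄≤m i)))) ⟩
    ẑ-mass i ℚ.+ fromℕ D̄              ∎
    where open ℚP.≤-Reasoning

  -- Only item k is rounded down, losing at most m̄ k ∸ ā k ≤ D̄ of the 2 D̄ covered by z*.
  D̄≤Σẑ-mass : fromℕ D̄ ℚ.≤ sumFin ẑ-mass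
  D̄≤Σẑ-mass = +-cancelʳ-≤ (fromℕ D̄) (begin
    fromℕ D̄ ℚ.+ fromℕ D̄         ≡⟨ sym (fromℕ-+ D̄ D̄) ⟩
    fromℕ (D̄ ℕ.+ D̄)            ≡⟨ cong (λ d → fromℕ (D̄ ℕ.+ d)) (sym (ℕP.+-identityʳ D̄)) ⟩
    fromℕ (2 ℕ.* D̄)            ≤⟨ proj₁ z*-feasible ⟩
    sumFin z*-mass              ≤⟨ sumFin-≤-except k z*-mass ẑ-mass (fromℕ-mono-≤ {0} {D̄} z≤n)
                                     (λ i not-k → ℚP.≤-reflexive (z*-mass≡ẑ-mass i not-k)) z*-mass≤ẑ-mass+D̄ ⟩
    sumFin ẑ-mass ℚ.+ fromℕ D̄   ∎)
    where open ℚP.≤-Reasoning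

  x̂-covers : D ℕ.≤ sumFinℕ x̂
  x̂-covers = ℕP.≤-trans (ℕP.m≤n+m∸n D (sumFinℕ ā)) (fromℕ-cancel-≤ (begin
    fromℕ (sumFinℕ ā ℕ.+ D̄)                             ≡⟨ fromℕ-+ (sumFinℕ ā) D̄ ⟩
    fromℕ (sumFinℕ ā) ℚ.+ fromℕ D̄                       ≤⟨ ℚP.+-monoʳ-≤ (fromℕ (sumFinℕ ā)) D̄≤Σẑ-mass ⟩
    fromℕ (sumFinℕ ā) ℚ.+ sumFin ẑ-mass                 ≡⟨ cong (ℚ._+ sumFin ẑ-mass) (sym (sumFin-fromℕ ā)) ⟩
    sumFin (λ i → fromℕ (ā i)) ℚ.+ sumFin ẑ-mass        ≡⟨ sym (Σℚ.ΣFin-⊕ (λ i → fromℕ (ā i)) ẑ-mass) ⟩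
    sumFin (λ i → fromℕ (ā i) ℚ.+ ẑ-mass i)             ≤⟨ Σℚ.ΣFin-mono ā+ẑ-mass≤x̂ ⟩
    sumFin (λ i → fromℕ (x̂ i))                          ≡⟨ sumFin-fromℕ x̂ ⟩
    fromℕ (sumFinℕ x̂)                                   ∎))
    where open ℚP.≤-Reasoning

  x̂-feasible : NLKCFeasible D m x̂
  x̂-feasible = x̂≤m , x̂-covers

  ẑ-GKCFeasible : GKCFeasible D m ẑ
  ẑ-GKCFeasible = GKCFeasible-cong (λ i j 1≤j j≤m → sym (ẑ≡step i j 1≤j j≤m)) (GKCFeasible-step x̂ x̂-feasible)

module Approximation
  {n D m : ℕ} (f : Fin n → ℕ → ℚ∞)
  (f-nonneg : ∀ i j q → j ℕ.≤ m → f i j ≡ fin q → 0ℚ ℚ.≤ q)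
  (f-mono : ∀ i j → j ℕ.< m → f i j ≤∞ f i (suc j))
  (z̄ : Vars n)
  (z̄-bounds : ∀ i j → 1 ℕ.≤ j → j ℕ.≤ m → 0ℚ ℚ.≤ z̄ i j × z̄ i j ℚ.≤ 1ℚ)
  (z̄-antitone : ∀ i → AntitoneOn m (z̄ i))
  (z̄-optimal : OptimalGKC D m f z̄)
  (z* : Vars n) (z*-optimal : OptimalR D m f (abar m z̄) z*)
  (k : Maybe (Fin n)) (z*-frac : FracItem D m (abar m z̄) z* k)
  where

  ā : Fin n → ℕ
  ā = abar m z̄

  ā≤m : ∀ i → ā i ℕ.≤ m
  ā≤m i = lastHalf≤ (z̄ i) m

  open Rounding ā ā≤m z* (proj₁ z*-optimal) k z*-frac public

  gcoef-nonneg : ∀ i j → 1 ℕ.≤ j → j ℕ.≤ m → Nonneg∞ (gcoef f i j)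
  gcoef-nonneg i (suc j) _ j<m = -∞-nonneg (f-mono i j j<m)

  weighted : Vars n → Fin n → ℕ → ℚ∞
  weighted z i j = scale (gcoef f i j) (z i j)

  lowCost highCost : Vars n → ℚ∞
  lowCost  z = sumFin∞ (λ i → sumR∞ 0 (ā i) (weighted z i))
  highCost z = sumFin∞ (λ i → sumR∞ (m̄ i) m (weighted z i))

  costG-split : ∀ z → costG m f z ≡ lowCost z +∞ (costR D m f ā z +∞ highCost z)
  costG-split z = begin
    costG m f z
      ≡⟨ Σ∞.ΣFin-cong (λ i → trans (Σ∞.Σ-split (weighted z i) z≤n (ā≤m i))
                                   (cong (low i +∞_) (Σ∞.Σ-split (weighted z i) (ā≤m̄ i) (m̄≤m i)))) ⟩
    sumFin∞ (λ i → low i +∞ (mid i +∞ high i))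
      ≡⟨ Σ∞.ΣFin-⊕ low (λ i → mid i +∞ high i) ⟩
    lowCost z +∞ sumFin∞ (λ i → mid i +∞ high i)
      ≡⟨ cong (lowCost z +∞_) (Σ∞.ΣFin-⊕ mid high) ⟩
    lowCost z +∞ (costR D m f ā z +∞ highCost z) ∎
    where
    open ≡-Reasoning
    low mid high : Fin n → ℚ∞
    low  i = sumR∞ 0 (ā i) (weighted z i)
    mid  i = sumR∞ (ā i) (m̄ i) (weighted z i)
    high i = sumR∞ (m̄ i) m (weighted z i)

  lowCost-ẑ : lowCost ẑ ≤∞ double (lowCost z̄)
  lowCost-ẑ = sumFin∞-sumR∞-≤double (λ _ → 0) ā (weighted ẑ) (weighted z̄) pointwise
    where
    pointwise : ∀ i j → 0 ℕ.< j → j ℕ.≤ ā i → weighted ẑ i j ≤∞ double (weighted z̄ i j)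
    pointwise i j 1≤j j≤ā = begin
      scale (gcoef f i j) (ẑ i j) ≡⟨ cong (scale (gcoef f i j)) (ẑ-≤ā j≤ā) ⟩
      scale (gcoef f i j) 1ℚ      ≡⟨ scale-1 (gcoef f i j) ⟩
      gcoef f i j                 ≲⟨ ≤∞-double-scale (gcoef-nonneg i j 1≤j (ℕP.≤-trans j≤ā (ā≤m i)))
                                                     (≤lastHalf⇒½≤ (z̄-antitone i) 1≤j j≤ā) ⟩
      double (weighted z̄ i j)     ∎
      where open ≤∞-Reasoning

  highCost-ẑ : highCost ẑ ≤∞ double (highCost z̄)
  highCost-ẑ = sumFin∞-sumR∞-≤double m̄ (λ _ → m) (weighted ẑ) (weighted z̄) pointwise
    where
    pointwise : ∀ i j → m̄ i ℕ.< j → j ℕ.≤ m → weighted ẑ i j ≤∞ double (weighted z̄ i j)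
    pointwise i j m̄<j j≤m = begin
      scale (gcoef f i j) (ẑ i j) ≡⟨ cong (scale (gcoef f i j)) (ẑ->m̄ m̄<j) ⟩
      scale (gcoef f i j) 0ℚ      ≡⟨ scale-0 (gcoef f i j) ⟩
      fin 0ℚ                      ≲⟨ 0≤w ⟩
      weighted z̄ i j              ≲⟨ x≤∞double 0≤w ⟩
      double (weighted z̄ i j)     ∎
      where
      open ≤∞-Reasoning
      1≤j = ℕP.m<n⇒0<n m̄<j
      0≤w = scale-nonneg (gcoef-nonneg i j 1≤j j≤m) (proj₁ (z̄-bounds i j 1≤j j≤m))

  2z̄ : Vars n
  2z̄ i j = z̄ i j ℚ.+ z̄ i j

  2z̄-RFeasible : RFeasible D m ā 2z̄
  2z̄-RFeasible = covers , bounds , antitone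
    where
    z̄-mass : Fin n → ℚ
    z̄-mass i = sumR (ā i) (m̄ i) (z̄ i)
    D̄≤Σz̄-mass : fromℕ D̄ ℚ.≤ sumFin z̄-mass
    D̄≤Σz̄-mass = ℚP.≤-trans (proj₂ (proj₁ z̄-optimal) ā ā≤m) (ℚP.≤-reflexive (Σℚ.ΣFin-cong (λ i →
      Σℚ.Σ-cong (ā i) (m̄ i) (λ j ā<j j≤m̄ →
        minUpTo-antitone (z̄-antitone i) j (ℕP.m<n⇒0<n ā<j) (ℕP.≤-trans j≤m̄ (m̄≤m i))))))
    covers : fromℕ (2 ℕ.* D̄) ℚ.≤ sumFin (λ i → sumR (ā i) (m̄ i) (2z̄ i))
    covers = begin
      fromℕ (2 ℕ.* D̄)                      ≡⟨ cong (λ d → fromℕ (D̄ ℕ.+ d)) (ℕP.+-identityʳ D̄) ⟩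
      fromℕ (D̄ ℕ.+ D̄)                      ≡⟨ fromℕ-+ D̄ D̄ ⟩
      fromℕ D̄ ℚ.+ fromℕ D̄                  ≤⟨ ℚP.+-mono-≤ D̄≤Σz̄-mass D̄≤Σz̄-mass ⟩
      sumFin z̄-mass ℚ.+ sumFin z̄-mass      ≡⟨ sym (Σℚ.ΣFin-⊕ z̄-mass z̄-mass) ⟩
      sumFin (λ i → z̄-mass i ℚ.+ z̄-mass i) ≡⟨ sym (Σℚ.ΣFin-cong (λ i → Σℚ.Σ-⊕ (ā i) (m̄ i) (z̄ i) (z̄ i))) ⟩
      sumFin (λ i → sumR (ā i) (m̄ i) (2z̄ i)) ∎
      where open ℚP.≤-Reasoning
    bounds : ∀ i j → InR D m ā i j → 0ℚ ℚ.≤ 2z̄ i j × 2z̄ i j ℚ.≤ 1ℚ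
    bounds i j (ā<j , j≤m̄) = ℚP.+-mono-≤ 0≤z̄ 0≤z̄ , ℚP.+-mono-≤ z̄≤½ z̄≤½
      where
      j≤m = ℕP.≤-trans j≤m̄ (m̄≤m i)
      0≤z̄ = proj₁ (z̄-bounds i j (ℕP.m<n⇒0<n ā<j) j≤m)
      z̄≤½ = ℚP.<⇒≤ (lastHalf<⇒<½ (z̄ i) m ā<j j≤m)
    antitone : ∀ i j → InR D m ā i j → InR D m ā i (suc j) → 2z̄ i (suc j) ℚ.≤ 2z̄ i j
    antitone i j (ā<j , _) (_ , sj≤m̄) = ℚP.+-mono-≤ z̄-step z̄-step
      where z̄-step = z̄-antitone i j (ℕP.m<n⇒0<n ā<j) (ℕP.≤-trans sj≤m̄ (m̄≤m i))

  costR-ẑ : costR D m f ā ẑ ≤∞ double (costR D m f ā z̄)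
  costR-ẑ = begin
    costR D m f ā ẑ          ≲⟨ Σ∞.ΣFin-mono (λ i → Σ∞.Σ-mono (ā i) (m̄ i) (ẑ≤z* i)) ⟩
    costR D m f ā z*         ≲⟨ proj₂ z*-optimal 2z̄ 2z̄-RFeasible ⟩
    costR D m f ā 2z̄         ≲⟨ sumFin∞-sumR∞-≤double ā m̄ (weighted 2z̄) (weighted z̄) (λ i j _ _ →
                                   scale-double (gcoef f i j) (z̄ i j)) ⟩
    double (costR D m f ā z̄) ∎
    where
    open ≤∞-Reasoning
    ẑ≤z* : ∀ i j → ā i ℕ.< j → j ℕ.≤ m̄ i → weighted ẑ i j ≤∞ weighted z* i j
    ẑ≤z* i j ā<j j≤m̄ = subst (_≤∞ weighted z* i j) (sym (cong (scale g) (ẑ-inR (ā<j , j≤m̄))))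
      (if-elim (λ v → scale g v ≤∞ scale g (z* i j)) (isItem k i) (λ _ → 0≤gz*) (λ _ → ≤∞-refl))
      where
      g = gcoef f i j
      0≤gz* : scale g 0ℚ ≤∞ scale g (z* i j)
      0≤gz* = subst (_≤∞ scale g (z* i j)) (sym (scale-0 g))
        (scale-nonneg (gcoef-nonneg i j (ℕP.m<n⇒0<n ā<j) (ℕP.≤-trans j≤m̄ (m̄≤m i)))
                      (proj₁ (z*-bounds i j (ā<j , j≤m̄))))

  costG-ẑ : costG m f ẑ ≤∞ double (costG m f z̄)
  costG-ẑ = begin
    costG m f ẑ
      ≡⟨ costG-split ẑ ⟩
    lowCost ẑ +∞ (costR D m f ā ẑ +∞ highCost ẑ)
      ≲⟨ +∞-mono-≤∞ lowCost-ẑ (+∞-mono-≤∞ costR-ẑ highCost-ẑ) ⟩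
    double (lowCost z̄) +∞ (double (costR D m f ā z̄) +∞ double (highCost z̄))
      ≡⟨ sym (trans (double-+ _ _) (cong (double (lowCost z̄) +∞_) (double-+ _ _))) ⟩
    double (lowCost z̄ +∞ (costR D m f ā z̄ +∞ highCost z̄))
      ≡⟨ cong double (sym (costG-split z̄)) ⟩
    double (costG m f z̄) ∎
    where open ≤∞-Reasoning

  F₀ : ℚ∞
  F₀ = sumFin∞ (λ i → f i 0)

  F₀-nonneg : Nonneg∞ F₀
  F₀-nonneg = Σ∞.ΣFin-nonneg (λ i → f i 0) f₀-nonneg
    where
    f₀-nonneg : ∀ i → Nonneg∞ (f i 0)
    f₀-nonneg i with f i 0 in eq
    ... | fin q = fin≤fin (f-nonneg i 0 q z≤n eq)
    ... | ∞     = _ ≤∞∞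

  x̂-2-approximate : ∀ x → NLKCFeasible D m x → costF f x̂ ≤∞ double (costF f x)
  x̂-2-approximate x x-feasible@(x≤m , _) = begin
    costF f x̂                                     ≡⟨ costF-step f f-mono x̂ x̂≤m ⟩
    F₀ +∞ costG m f (stepVars x̂)                  ≡⟨ cong (F₀ +∞_) (costG-cong m f (λ i j 1≤j j≤m → sym (ẑ≡step i j 1≤j j≤m))) ⟩
    F₀ +∞ costG m f ẑ                             ≲⟨ +∞-mono-≤∞ ≤∞-refl costG-ẑ ⟩
    F₀ +∞ double (costG m f z̄)                    ≲⟨ +∞-mono-≤∞ (x≤∞double F₀-nonneg) (double-mono z̄≤x) ⟩
    double F₀ +∞ double (costG m f (stepVars x))  ≡⟨ sym (double-+ F₀ _) ⟩
    double (F₀ +∞ costG m f (stepVars x))         ≡⟨ cong double (sym (costF-step f f-mono x x≤m)) ⟩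
    double (costF f x)                            ∎
    where
    open ≤∞-Reasoning
    z̄≤x : costG m f z̄ ≤∞ costG m f (stepVars x)
    z̄≤x = proj₂ z̄-optimal (stepVars x) (GKCFeasible-step x x-feasible)

theorem2 :
  (n D m : ℕ) (f : Fin n → ℕ → ℚ∞) →
  m ≤ D →
  (∀ i j q → j ≤ m → f i j ≡ fin q → 0ℚ ≤ℚ q) →
  (∀ i j → j < m → f i j ≤∞ f i (suc j)) →
  Σ (Fin n → ℕ) (λ x → NLKCFeasible D m x × Σ ℚ (λ c → costF f x ≡ fin c)) →
  (zbar : Vars n) →
  (∀ i j → 1 ≤ j → j ≤ m → 0ℚ ≤ℚ zbar i j × zbar i j ≤ℚ 1ℚ) →
  (∀ i j → 1 ≤ j → j < m → zbar i (suc j) ≤ℚ zbar i j) →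
  OptimalGKC D m f zbar →
  (zs : Vars n) →
  OptimalR D m f (abar m zbar) zs →
  ExtremeR D m (abar m zbar) zs →
  (k : Maybe (Fin n)) →
  FracItem D m (abar m zbar) zs k →
  (∀ i j → 1 ≤ j → j ≤ m → IsIntegral (zhat D m (abar m zbar) zs k i j)) ×
  GKCFeasible D m (zhat D m (abar m zbar) zs k) ×
  costG m f (zhat D m (abar m zbar) zs k) ≤∞ double (costG m f zbar) ×
  Σ (Fin n → ℕ) (λ xhat →
    NLKCFeasible D m xhat ×
    (∀ i j → 1 ≤ j → j ≤ m →
       zhat D m (abar m zbar) zs k i j ≡ (if j ≤ᵇ xhat i then 1ℚ else 0ℚ)) ×
    (∀ x → NLKCFeasible D m x → costF f xhat ≤∞ double (costF f x)))
theorem2 n D m f _ f-nonneg f-mono _ zbar zbar-bounds zbar-antitone zbar-optimal zs zs-optimal _ k zs-frac =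
  ẑ-integral , ẑ-GKCFeasible , costG-ẑ , x̂ , x̂-feasible , ẑ≡step , x̂-2-approximate
  where
  open Approximation f f-nonneg f-mono zbar zbar-bounds zbar-antitone zbar-optimal zs zs-optimal k zs-frac
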